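{- Let $d$ be an odd positive integer. Regular $3$-designs of size $n$ on $S^d$ exist when (i) $n$ is even and $n \geq 2d+2$; (ii) $n$ is odd and $n \geq 3d+2$; and (iii) $n$ is odd and $n \geq \frac{p}{p+1}(3d+3)$, where $p$ is a divisor of $n$ which is congruent to $5 \pmod 6$. In particular, there are regular $3$-designs of size $n$ on $S^d$ when $n$ is an odd integer divisible by $5$ and $n \geq 5(d+1)/2$.
   Context: A set $S$ of residues modulo $n$ is a Sidon-type set of strength $t$ in $\mathbb{Z}_n$ if there is no non-trivial sum $\varepsilon_1 x_1 + \cdots + \varepsilon_t x_t \equiv 0 \pmod n$ with $\varepsilon_i \in \{0,1,-1\}$ and $x_i \in S$ (not necessarily distinct); a sum is non-trivial if some $\varepsilon_i \neq 0$ and no element of $S$ appears both with coefficient $+1$ and $-1$. For $d$ odd, $e=(d+1)/2$, and $S = \{m_1,\dots,m_e\}$ a Sidon-type set of strength $s$ in $\mathbb{Z}_n$ with $e$ elements, let $A(S)$ be the $2e\times n$ matrix with rows $s(m_1), c(m_1), \dots, s(m_e), c(m_e)$, where $s(m) = (\sin(\frac{2\pi}{n}km))_{k=1}^n$, $c(m) = (\cos(\frac{2\pi}{n}km))_{k=1}^n$. The $n$ columns of $\sqrt{2/(d+1)}\,A(S)$ are called a regular $s$-design of size $n$ on $S^d$ (they form a spherical $s$-design on $S^d$, i.e. the average of any polynomial of degree $\le s$ over these $n$ points equals its average over $S^d$). -}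

module Defs where

open import Data.Nat using (ℕ; zero; suc; _/_)
open import Data.Fin using (Fin; toℕ)
import Data.Fin as F
open import Data.Integer using (ℤ; +_; -_; _+_; _*_)
open import Data.Integer.Divisibility using (_∣_)
open import Data.Product using (Σ; ∃; ∃-syntax; _×_)
open import Relation.Binary.PropositionalEquality using (_≡_; _≢_)
open import Relation.Nullary using (¬_)
open import Function.Definitions using (Injective)

data Coef : Set where
  c0 c+ c- : Coef

coefVal : Coef → ℤ
coefVal c0 = + 0
coefVal c+ = + 1
coefVal c- = - (+ 1)

sumFin : (t : ℕ) → (Fin t → ℤ) → ℤ
sumFin zero    f = + 0
sumFin (suc t) f = f F.zero + sumFin t (λ i → f (F.suc i))

-- A set S = {m_1,…,m_e} of e distinct residues mod n is given by an injective
-- map m : Fin e → Fin n. A signed sum of length t is given by coefficients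
-- ε : Fin t → Coef and choices x : Fin t → Fin e (x_i = m (x i)).
NonTrivial : {t e : ℕ} → (Fin t → Coef) → (Fin t → Fin e) → Set
NonTrivial {t} ε x =
  (∃[ i ] ε i ≢ c0) ×
  ¬ (∃[ i ] ∃[ j ] (x i ≡ x j × ε i ≡ c+ × ε j ≡ c-))

SignedSum : {t e n : ℕ} → (Fin e → Fin n) → (Fin t → Coef) → (Fin t → Fin e) → ℤ
SignedSum {t} m ε x = sumFin t (λ i → coefVal (ε i) * (+ toℕ (m (x i))))

SidonType : (t n : ℕ) {e : ℕ} → (Fin e → Fin n) → Set
SidonType t n {e} m =
  (ε : Fin t → Coef) (x : Fin t → Fin e) →
  NonTrivial ε x → ¬ ((+ n) ∣ SignedSum m ε x)

halfSucc : ℕ → ℕ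
halfSucc d = suc d / 2

-- A regular s-design of size n on S^d (d odd) is, by definition, the set of
-- columns of √(2/(d+1)) A(S) for some Sidon-type set S of strength s in ℤ_n with
-- e = (d+1)/2 elements; so such a design exists iff such an S exists.
RegularDesignExists : (s n d : ℕ) → Set
RegularDesignExists s n d =
  Σ (Fin (halfSucc d) → Fin n) λ m → Injective _≡_ _≡_ m × SidonType s n m

-- Write S for the image of the residues in ℤ_n. If 0 ∉ S, 0 ∉ S + S, 0 ∉ S + S + S and
-- S ∩ (S + S) = ∅, then S is a Sidon-type set of strength 3: up to an overall sign, a
-- non-trivial signed sum of at most three elements has the shape x, x + y, x + y + z,
-- x − y with x ≠ y, or x + y − z. Two families of such sets give the three cases.
-- The odd residues 1, 3, …, 2e − 1 with 4e ≤ n: sums of one or two of them lie below n,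
-- and sums of two are even while the elements are odd. A sum of three is odd, so it is
-- nonzero mod n by parity when n is even, and by size when 6e ≤ n + 2.
-- If p = 6k + 5 divides n, the residues whose reduction mod p lies in the middle third
-- [2k + 2, 3k + 2] of ℤ_p: mod p, sums of two lie in [4k + 4, 6k + 4] and sums of three
-- in [1, 3k + 1]. There are (k + 1)·n/p such residues.
module Submission where

open import Defs
open import Data.Nat using (ℕ; zero; suc; _+_; _*_; _≤_; _<_; s≤s; z≤n; _%_; _/_; _∸_; NonZero; >-nonZero; >-nonZero⁻¹)
open import Data.Nat.Properties as ℕ
  using (≤-trans; ≤-refl; ≤-total; +-comm; +-assoc; +-suc; +-identityʳ; *-comm; *-assoc; *-suc; +-mono-≤; +-mono-<; <⇒≢; m∸n+n≡m; m≤m+n; m≤n⇒m≤1+n; m*n≢0; m*n≢0⇒m≢0; *-cancelˡ-≤; module ≤-Reasoning)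
open import Data.Nat.DivMod using (m≡m%n+[m/n]*n; m<n⇒m%n≡m; m*n/n≡m; [m+n]%n≡m%n; [m+kn]%n≡m%n; %-remove-+ˡ; %-distribˡ-+; m∣n⇒o%n%m≡o%m)
open import Data.Nat.Divisibility using (_∣_; divides; m∣m*n; n∣m*n; m%n≡0⇒n∣m)
open import Data.Nat.ListAction using (sum)
open import Data.Nat.Tactic.RingSolver as ℕ-Solver using ()
import Data.Integer as ℤ
open ℤ using (ℤ; +_; _⊖_; ∣_∣)
open import Data.Integer.Properties using (pos-+; [+m]-[+n]≡m⊖n; ∣m⊖n∣≡∣n⊖m∣; ∣⊖∣-≤)
import Data.Integer.Divisibility as ℤ
open import Data.Integer.Tactic.RingSolver as ℤ-Solver using ()
open import Data.Fin as F using (Fin; toℕ; combine; quotient; remainder; inject≤; _↑ʳ_)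
open import Data.Fin.Properties
  using (toℕ<n; toℕ≤pred[n]; toℕ-injective; toℕ-combine; combine-injective; combine-injectiveˡ; combine-remQuot; toℕ-inject≤; inject≤-injective; ↑ʳ-injective; toℕ-↑ʳ)
open import Data.List using (List; []; _∷_; map; length)
open import Data.List.Membership.Propositional using (_∈_)
open import Data.List.Relation.Unary.Any using (here; there)
open import Data.List.Relation.Binary.Disjoint.Propositional using (Disjoint)
open import Data.Product as Σ using (Σ; ∃-syntax; _×_; _,_; proj₁; proj₂)
open import Data.Sum as Sum using (_⊎_; inj₁; inj₂)
open import Function using (_∘_; id; case_of_)
open import Function.Definitions using (Injective)
open import Relation.Binary.Definitions using (DecidableEquality)
open import Relation.Binary.PropositionalEquality
open import Relation.Nullary using (yes; no; contradiction)

module _ {n : ℕ} .{{_ : NonZero n}} where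

  <⇒%-injective : ∀ {x y} → x < n → y < n → x % n ≡ y % n → x ≡ y
  <⇒%-injective x<n y<n x≡y = trans (sym (m<n⇒m%n≡m x<n)) (trans x≡y (m<n⇒m%n≡m y<n))

  ∣∸⇒%≡ : ∀ {x y} → y ≤ x → n ∣ x ∸ y → x % n ≡ y % n
  ∣∸⇒%≡ {x} {y} y≤x n∣x∸y = begin
    x % n           ≡⟨ cong (_% n) (m∸n+n≡m y≤x) ⟨
    (x ∸ y + y) % n ≡⟨ %-remove-+ˡ y n∣x∸y ⟩
    y % n           ∎
    where open ≡-Reasoning

  ∣⊖∣⇒%≡ : ∀ x y → n ∣ ∣ x ⊖ y ∣ → x % n ≡ y % n
  ∣⊖∣⇒%≡ x y n∣x⊖y with ≤-total y x
  ... | inj₁ y≤x = ∣∸⇒%≡ y≤x (subst (n ∣_) (trans (∣m⊖n∣≡∣n⊖m∣ x y) (∣⊖∣-≤ y≤x)) n∣x⊖y)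
  ... | inj₂ x≤y = sym (∣∸⇒%≡ x≤y (subst (n ∣_) (∣⊖∣-≤ x≤y) n∣x⊖y))

  ∣-⇒%≡ : ∀ x y → + n ℤ.∣ + x ℤ.- + y → x % n ≡ y % n
  ∣-⇒%≡ x y = ∣⊖∣⇒%≡ x y ∘ subst (λ z → n ∣ ∣ z ∣) ([+m]-[+n]≡m⊖n x y)

  %-cong-+ : ∀ {x x′ y y′} → x % n ≡ x′ % n → y % n ≡ y′ % n → (x + y) % n ≡ (x′ + y′) % n
  %-cong-+ {x} {x′} {y} {y′} x≡x′ y≡y′ = begin
    (x + y) % n             ≡⟨ %-distribˡ-+ x y n ⟩
    (x % n + y % n) % n     ≡⟨ cong₂ (λ a b → (a + b) % n) x≡x′ y≡y′ ⟩
    (x′ % n + y′ % n) % n   ≡⟨ %-distribˡ-+ x′ y′ n ⟨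
    (x′ + y′) % n           ∎
    where open ≡-Reasoning

%≡⇒≡+* : ∀ {m n r} .{{_ : NonZero n}} → m % n ≡ r → m ≡ r + n * (m / n)
%≡⇒≡+* {m} {n} refl = trans (m≡m%n+[m/n]*n m n) (cong (λ x → m % n + x) (*-comm (m / n) n))

_≟ᶜ_ : DecidableEquality Coef
c0 ≟ᶜ c0 = yes refl
c0 ≟ᶜ c+ = no λ ()
c0 ≟ᶜ c- = no λ ()
c+ ≟ᶜ c0 = no λ ()
c+ ≟ᶜ c+ = yes refl
c+ ≟ᶜ c- = no λ ()
c- ≟ᶜ c0 = no λ ()
c- ≟ᶜ c+ = no λ ()
c- ≟ᶜ c- = yes refl

module _ {A : Set} where

  consIfSame : Coef → Coef → A → List A → List A
  consIfSame c c′ a as with c ≟ᶜ c′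
  ... | yes _ = a ∷ as
  ... | no  _ = as

  occurrences : ∀ {t} → Coef → (Fin t → Coef) → (Fin t → A) → List A
  occurrences {zero}  c ε x = []
  occurrences {suc t} c ε x = consIfSame c (ε F.zero) (x F.zero) (occurrences c (ε ∘ F.suc) (x ∘ F.suc))

  ∈-occurrences⁺ : ∀ {t c} (ε : Fin t → Coef) (x : Fin t → A) i → ε i ≡ c → x i ∈ occurrences c ε x
  ∈-occurrences⁺ {c = c} ε x F.zero εi≡c with c ≟ᶜ ε F.zero
  ... | yes _   = here refl
  ... | no c≢ε₀ = contradiction (sym εi≡c) c≢ε₀
  ∈-occurrences⁺ {c = c} ε x (F.suc i) εi≡c with c ≟ᶜ ε F.zero
  ... | yes _ = there (∈-occurrences⁺ (ε ∘ F.suc) (x ∘ F.suc) i εi≡c)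
  ... | no  _ = ∈-occurrences⁺ (ε ∘ F.suc) (x ∘ F.suc) i εi≡c

  ∈-occurrences⁻ : ∀ {t c a} (ε : Fin t → Coef) (x : Fin t → A) →
                   a ∈ occurrences c ε x → ∃[ i ] ε i ≡ c × x i ≡ a
  ∈-occurrences⁻ {suc t} {c} ε x a∈ with c ≟ᶜ ε F.zero | a∈
  ... | yes c≡ε₀ | here a≡x₀ = F.zero , sym c≡ε₀ , sym a≡x₀
  ... | yes _    | there a∈′ = Σ.map F.suc id (∈-occurrences⁻ (ε ∘ F.suc) (x ∘ F.suc) a∈′)
  ... | no _     | a∈′       = Σ.map F.suc id (∈-occurrences⁻ (ε ∘ F.suc) (x ∘ F.suc) a∈′)

  length-occurrences : ∀ {t} (ε : Fin t → Coef) (x : Fin t → A) →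
                       length (occurrences c+ ε x) + length (occurrences c- ε x) ≤ t
  length-occurrences {zero}  ε x = z≤n
  length-occurrences {suc t} ε x with ε F.zero | length-occurrences (ε ∘ F.suc) (x ∘ F.suc)
  ... | c0 | ih = m≤n⇒m≤1+n ih
  ... | c+ | ih = s≤s ih
  ... | c- | ih = subst (_≤ suc t) (sym (+-suc _ _)) (s≤s ih)

  signedSum-consIfSame : ∀ (w : A → ℕ) c a P N →
    coefVal c ℤ.* + w a ℤ.+ (+ sum (map w P) ℤ.- + sum (map w N)) ≡
    + sum (map w (consIfSame c+ c a P)) ℤ.- + sum (map w (consIfSame c- c a N))
  signedSum-consIfSame w c0 a P N = identity (+ w a) (+ sum (map w P)) (+ sum (map w N))
    where identity : ∀ a p n → coefVal c0 ℤ.* a ℤ.+ (p ℤ.- n) ≡ p ℤ.- n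
          identity = ℤ-Solver.solve-∀
  signedSum-consIfSame w c+ a P N =
    trans (identity (+ w a) (+ sum (map w P)) (+ sum (map w N)))
          (cong (λ s → s ℤ.- + sum (map w N)) (sym (pos-+ (w a) (sum (map w P)))))
    where identity : ∀ a p n → coefVal c+ ℤ.* a ℤ.+ (p ℤ.- n) ≡ (a ℤ.+ p) ℤ.- n
          identity = ℤ-Solver.solve-∀
  signedSum-consIfSame w c- a P N =
    trans (identity (+ w a) (+ sum (map w P)) (+ sum (map w N)))
          (cong (λ s → + sum (map w P) ℤ.- s) (sym (pos-+ (w a) (sum (map w N)))))
    where identity : ∀ a p n → coefVal c- ℤ.* a ℤ.+ (p ℤ.- n) ≡ p ℤ.- (a ℤ.+ n)
          identity = ℤ-Solver.solve-∀

  signedSum-occurrences : ∀ {t} (ε : Fin t → Coef) (x : Fin t → A) (w : A → ℕ) →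
    sumFin t (λ i → coefVal (ε i) ℤ.* + w (x i)) ≡
    + sum (map w (occurrences c+ ε x)) ℤ.- + sum (map w (occurrences c- ε x))
  signedSum-occurrences {zero}  ε x w = refl
  signedSum-occurrences {suc t} ε x w = trans
    (cong (λ s → coefVal (ε F.zero) ℤ.* + w (x F.zero) ℤ.+ s) (signedSum-occurrences (ε ∘ F.suc) (x ∘ F.suc) w))
    (signedSum-consIfSame w (ε F.zero) (x F.zero) _ _)

-- Sum-free residues and Sidon-type sets of strength 3

record SumFreeMod (n : ℕ) .{{_ : NonZero n}} {A : Set} (w : A → ℕ) : Set where
  field
    single≢0    : ∀ a → w a % n ≢ 0 % n
    pair≢0      : ∀ a b → (w a + w b) % n ≢ 0 % n
    triple≢0    : ∀ a b c → (w a + w b + w c) % n ≢ 0 % n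
    pair≢single : ∀ a b c → (w a + w b) % n ≢ w c % n

module _ {A B : Set} {w : A → ℕ} {v : B → ℕ} {n : ℕ} .{{_ : NonZero n}} where

  SumFreeMod-residues : (f : A → B) → (∀ a → w a % n ≡ v (f a) % n) → SumFreeMod n v → SumFreeMod n w
  SumFreeMod-residues f w≡v sumFree = record
    { single≢0    = λ a → single≢0 (f a) ∘ trans (sym (w≡v a))
    ; pair≢0      = λ a b → pair≢0 (f a) (f b) ∘ trans (sym (pair a b))
    ; triple≢0    = λ a b c → triple≢0 (f a) (f b) (f c) ∘ trans (sym (%-cong-+ (pair a b) (w≡v c)))
    ; pair≢single = λ a b c eq → pair≢single (f a) (f b) (f c) (trans (sym (pair a b)) (trans eq (w≡v c)))
    }
    where
    open SumFreeMod sumFree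
    pair : ∀ a b → (w a + w b) % n ≡ (v (f a) + v (f b)) % n
    pair a b = %-cong-+ (w≡v a) (w≡v b)

module _ {M n : ℕ} .{{_ : NonZero M}} .{{_ : NonZero n}} (M∣n : M ∣ n) where

  %-reduce : ∀ {x y} → x % n ≡ y % n → x % M ≡ y % M
  %-reduce {x} {y} x≡y = begin
    x % M     ≡⟨ m∣n⇒o%n%m≡o%m M n x M∣n ⟨
    x % n % M ≡⟨ cong (_% M) x≡y ⟩
    y % n % M ≡⟨ m∣n⇒o%n%m≡o%m M n y M∣n ⟩
    y % M     ∎
    where open ≡-Reasoning

  SumFreeMod-∣ : ∀ {A : Set} {w : A → ℕ} → SumFreeMod M w → SumFreeMod n w
  SumFreeMod-∣ sumFree = record
    { single≢0    = λ a → single≢0 a ∘ %-reduce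
    ; pair≢0      = λ a b → pair≢0 a b ∘ %-reduce
    ; triple≢0    = λ a b c → triple≢0 a b c ∘ %-reduce
    ; pair≢single = λ a b c → pair≢single a b c ∘ %-reduce
    }
    where open SumFreeMod sumFree

module _ {A : Set} {n : ℕ} .{{_ : NonZero n}} {w : A → ℕ}
         (w-injective : ∀ {a b} → w a % n ≡ w b % n → a ≡ b) (sumFree : SumFreeMod n w) where

  open SumFreeMod sumFree

  private
    ≢-by : ∀ {x x′ y y′} → x ≡ x′ → y ≡ y′ → x′ % n ≢ y′ % n → x % n ≢ y % n
    ≢-by refl refl x≢y = x≢y

    sum₁ : ∀ a → sum (map w (a ∷ [])) ≡ w a
    sum₁ a = +-identityʳ (w a)

    sum₂ : ∀ a b → sum (map w (a ∷ b ∷ [])) ≡ w a + w b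
    sum₂ a b = cong (λ s → w a + s) (sum₁ b)

    sum₃ : ∀ a b c → sum (map w (a ∷ b ∷ c ∷ [])) ≡ w a + w b + w c
    sum₃ a b c = trans (cong (λ s → w a + s) (sum₂ b c)) (sym (+-assoc (w a) (w b) (w c)))

  disjoint-sums-incongruent : ∀ P N → Disjoint P N → ∃[ a ] (a ∈ P ⊎ a ∈ N) →
                              length P + length N ≤ 3 → sum (map w P) % n ≢ sum (map w N) % n
  disjoint-sums-incongruent [] [] _ (_ , inj₁ ()) _
  disjoint-sums-incongruent [] [] _ (_ , inj₂ ()) _
  disjoint-sums-incongruent (a ∷ [])          []                _ _ _ = ≢-by (sum₁ a) refl (single≢0 a)
  disjoint-sums-incongruent []                (a ∷ [])          _ _ _ = ≢-sym (≢-by (sum₁ a) refl (single≢0 a))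
  disjoint-sums-incongruent (a ∷ b ∷ [])      []                _ _ _ = ≢-by (sum₂ a b) refl (pair≢0 a b)
  disjoint-sums-incongruent []                (a ∷ b ∷ [])      _ _ _ = ≢-sym (≢-by (sum₂ a b) refl (pair≢0 a b))
  disjoint-sums-incongruent (a ∷ b ∷ c ∷ [])  []                _ _ _ = ≢-by (sum₃ a b c) refl (triple≢0 a b c)
  disjoint-sums-incongruent []                (a ∷ b ∷ c ∷ [])  _ _ _ = ≢-sym (≢-by (sum₃ a b c) refl (triple≢0 a b c))
  disjoint-sums-incongruent (a ∷ [])          (b ∷ [])          P#N _ _ =
    ≢-by (sum₁ a) (sum₁ b) λ wa≡wb → P#N (here refl , here (w-injective wa≡wb))
  disjoint-sums-incongruent (a ∷ b ∷ [])      (c ∷ [])          _ _ _ = ≢-by (sum₂ a b) (sum₁ c) (pair≢single a b c)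
  disjoint-sums-incongruent (c ∷ [])          (a ∷ b ∷ [])      _ _ _ = ≢-sym (≢-by (sum₂ a b) (sum₁ c) (pair≢single a b c))
  disjoint-sums-incongruent (_ ∷ _ ∷ _ ∷ _ ∷ _) _                _ _ (s≤s (s≤s (s≤s ())))
  disjoint-sums-incongruent (_ ∷ _ ∷ _ ∷ [])  (_ ∷ _)           _ _ (s≤s (s≤s (s≤s ())))
  disjoint-sums-incongruent (_ ∷ _ ∷ [])      (_ ∷ _ ∷ _)       _ _ (s≤s (s≤s (s≤s ())))
  disjoint-sums-incongruent (_ ∷ [])          (_ ∷ _ ∷ _ ∷ _)   _ _ (s≤s (s≤s (s≤s ())))
  disjoint-sums-incongruent []                (_ ∷ _ ∷ _ ∷ _ ∷ _) _ _ (s≤s (s≤s (s≤s ())))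

sumFree⇒sidon : ∀ {t e n} .{{_ : NonZero n}} (m : Fin e → Fin n) → Injective _≡_ _≡_ m →
                SumFreeMod n (toℕ ∘ m) → t ≤ 3 → SidonType t n m
sumFree⇒sidon {n = n} m m-injective sumFree t≤3 ε x ((i , εi≢c0) , noCancellation) n∣Σ =
  disjoint-sums-incongruent w-injective sumFree P N P#N (signed-element (ε i) refl)
    (≤-trans (length-occurrences ε x) t≤3)
    (∣-⇒%≡ _ _ (subst (+ n ℤ.∣_) (signedSum-occurrences ε x (toℕ ∘ m)) n∣Σ))
  where
  P = occurrences c+ ε x
  N = occurrences c- ε x

  w-injective : ∀ {a b} → toℕ (m a) % n ≡ toℕ (m b) % n → a ≡ b
  w-injective = m-injective ∘ toℕ-injective ∘ <⇒%-injective (toℕ<n _) (toℕ<n _)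

  P#N : Disjoint P N
  P#N (a∈P , a∈N) with i , εi≡c+ , xi≡a ← ∈-occurrences⁻ ε x a∈P
                     | j , εj≡c- , xj≡a ← ∈-occurrences⁻ ε x a∈N =
    noCancellation (i , j , trans xi≡a (sym xj≡a) , εi≡c+ , εj≡c-)

  signed-element : ∀ c → ε i ≡ c → ∃[ a ] (a ∈ P ⊎ a ∈ N)
  signed-element c0 εi≡c0 = contradiction εi≡c0 εi≢c0
  signed-element c+ εi≡c+ = x i , inj₁ (∈-occurrences⁺ ε x i εi≡c+)
  signed-element c- εi≡c- = x i , inj₂ (∈-occurrences⁺ ε x i εi≡c-)

-- RegularDesignExists s n d unfolds to SidonSetExists s n (halfSucc d).
SidonSetExists : (s n e : ℕ) → Set
SidonSetExists s n e = Σ (Fin e → Fin n) λ m → Injective _≡_ _≡_ m × SidonType s n m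

odd%2 : ∀ k → suc (2 * k) % 2 ≡ 1
odd%2 k = trans (cong (λ m → suc m % 2) (*-comm 2 k)) ([m+kn]%n≡m%n 1 k 2)

odd+odd%2 : ∀ k l → (suc (2 * k) + suc (2 * l)) % 2 ≡ 0
odd+odd%2 k l = trans (%-distribˡ-+ (suc (2 * k)) (suc (2 * l)) 2)
                      (cong₂ (λ x y → (x + y) % 2) (odd%2 k) (odd%2 l))

odd+odd+odd%2 : ∀ k l m → (suc (2 * k) + suc (2 * l) + suc (2 * m)) % 2 ≡ 1
odd+odd+odd%2 k l m = trans (%-distribˡ-+ (suc (2 * k) + suc (2 * l)) (suc (2 * m)) 2)
                            (cong₂ (λ x y → (x + y) % 2) (odd+odd%2 k l) (odd%2 m))

module _ {e : ℕ} where

  odd : Fin e → ℕ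
  odd a = suc (2 * toℕ a)

  odd<2e : ∀ a → odd a < 2 * e
  odd<2e a = subst (_≤ 2 * e) (*-suc 2 (toℕ a)) (ℕ.*-monoʳ-≤ 2 (toℕ<n a))

  odd-sumFree : ∀ {n} .{{_ : NonZero n}} → 4 * e ≤ n → 2 ∣ n ⊎ 6 * e ≤ 2 + n → SumFreeMod n odd
  odd-sumFree {n} 4e≤n 2∣n⊎6e≤2+n = record
    { single≢0    = λ a eq → case <⇒%-injective (single<n a) 0<n eq of λ ()
    ; pair≢0      = λ a b eq → case <⇒%-injective (pair<n a b) 0<n eq of λ ()
    ; triple≢0    = triple≢0 2∣n⊎6e≤2+n
    ; pair≢single = λ a b c eq → case trans (sym (odd+odd%2 (toℕ a) (toℕ b)))
        (trans (cong (_% 2) (<⇒%-injective (pair<n a b) (single<n c) eq)) (odd%2 (toℕ c))) of λ ()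
    }
    where
    0<n : 0 < n
    0<n = >-nonZero⁻¹ n

    2e+2e≤n : 2 * e + 2 * e ≤ n
    2e+2e≤n = subst (_≤ n) (split e) 4e≤n
      where split : ∀ x → 4 * x ≡ 2 * x + 2 * x
            split = ℕ-Solver.solve-∀

    single<n : ∀ a → odd a < n
    single<n a = ≤-trans (odd<2e a) (≤-trans (m≤m+n (2 * e) (2 * e)) 2e+2e≤n)

    pair<n : ∀ a b → odd a + odd b < n
    pair<n a b = ≤-trans (+-mono-< (odd<2e a) (odd<2e b)) 2e+2e≤n

    triple≢0 : 2 ∣ n ⊎ 6 * e ≤ 2 + n → ∀ a b c → (odd a + odd b + odd c) % n ≢ 0 % n
    triple≢0 (inj₁ 2∣n) a b c eq =
      case trans (sym (odd+odd+odd%2 (toℕ a) (toℕ b) (toℕ c))) (%-reduce 2∣n eq) of λ ()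
    triple≢0 (inj₂ 6e≤2+n) a b c eq = case <⇒%-injective triple<n 0<n eq of λ ()
      where
      triple<n : odd a + odd b + odd c < n
      triple<n = ℕ.+-cancelˡ-≤ 2 _ _ (begin
        2 + suc (odd a + odd b + odd c)         ≡⟨ regroup (odd a) (odd b) (odd c) ⟩
        suc (odd a) + suc (odd b) + suc (odd c) ≤⟨ +-mono-≤ (+-mono-≤ (odd<2e a) (odd<2e b)) (odd<2e c) ⟩
        2 * e + 2 * e + 2 * e                   ≡⟨ 2x+2x+2x≡6x e ⟩
        6 * e                                   ≤⟨ 6e≤2+n ⟩
        2 + n                                   ∎)
        where
        open ≤-Reasoning
        regroup : ∀ x y z → 2 + suc (x + y + z) ≡ suc x + suc y + suc z
        regroup = ℕ-Solver.solve-∀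
        2x+2x+2x≡6x : ∀ x → 2 * x + 2 * x + 2 * x ≡ 6 * x
        2x+2x+2x≡6x = ℕ-Solver.solve-∀

oddSidonSet : ∀ {e n} .{{_ : NonZero n}} → 4 * e ≤ n → 2 ∣ n ⊎ 6 * e ≤ 2 + n → SidonSetExists 3 n e
oddSidonSet {e} {n} 4e≤n 2∣n⊎6e≤2+n = m , m-injective , sumFree⇒sidon m m-injective sumFree ≤-refl
  where
  2e≤n : e * 2 ≤ n
  2e≤n = ≤-trans (subst (e * 2 ≤_) (split e) (m≤m+n _ _)) 4e≤n
    where split : ∀ e → e * 2 + e * 2 ≡ 4 * e
          split = ℕ-Solver.solve-∀

  m : Fin e → Fin n
  m a = inject≤ (combine a (F.suc F.zero)) 2e≤n

  m-injective : Injective _≡_ _≡_ m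
  m-injective {a} {b} eq = combine-injectiveˡ a _ b _
    (inject≤-injective 2e≤n 2e≤n (combine a (F.suc F.zero)) (combine b (F.suc F.zero)) eq)

  sumFree : SumFreeMod n (toℕ ∘ m)
  sumFree = SumFreeMod-residues id
    (λ a → cong (_% n) (trans (toℕ-inject≤ (combine a (F.suc F.zero)) 2e≤n) (trans (toℕ-combine a _) (+-comm _ 1))))
    (odd-sumFree 4e≤n 2∣n⊎6e≤2+n)

-- The middle third of ℤ_p for p = 6k + 5

module _ (k : ℕ) where

  middle : Fin (suc k) → ℕ
  middle t = 2 * suc k + toℕ t

  middle-sumFree : SumFreeMod (5 + 6 * k) middle
  middle-sumFree = record
    { single≢0    = λ a eq → case <⇒%-injective (single<p a) 0<p eq of λ ()
    ; pair≢0      = λ a b eq → case <⇒%-injective (pair<p a b) 0<p eq of λ ()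
    ; triple≢0    = triple≢0
    ; pair≢single = λ a b c eq → <⇒≢ (single<pair a b c) (sym (<⇒%-injective (pair<p a b) (single<p c) eq))
    }
    where
    p = 5 + 6 * k
    0<p : 0 < p
    0<p = s≤s z≤n

    middle≤ : ∀ t → middle t ≤ 2 * suc k + k
    middle≤ t = ℕ.+-monoʳ-≤ (2 * suc k) (toℕ≤pred[n] t)

    single<p : ∀ a → middle a < p
    single<p a = ≤-trans (s≤s (middle≤ a)) (subst (suc (2 * suc k + k) ≤_) (split k) (m≤m+n _ _))
      where split : ∀ k → suc (2 * suc k + k) + (2 + 3 * k) ≡ 5 + 6 * k
            split = ℕ-Solver.solve-∀

    pair<p : ∀ a b → middle a + middle b < p
    pair<p a b = subst (middle a + middle b <_) (split k) (s≤s (+-mono-≤ (middle≤ a) (middle≤ b)))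
      where split : ∀ k → suc (2 * suc k + k + (2 * suc k + k)) ≡ 5 + 6 * k
            split = ℕ-Solver.solve-∀

    single<pair : ∀ a b c → middle c < middle a + middle b
    single<pair a b c = begin-strict
      2 * suc k + toℕ c     <⟨ ℕ.+-monoʳ-< (2 * suc k) (≤-trans (toℕ<n c) (m≤m+n (suc k) (suc k + 0))) ⟩
      2 * suc k + 2 * suc k ≤⟨ +-mono-≤ (m≤m+n (2 * suc k) (toℕ a)) (m≤m+n (2 * suc k) (toℕ b)) ⟩
      middle a + middle b   ∎
      where open ≤-Reasoning

    triple≢0 : ∀ a b c → (middle a + middle b + middle c) % p ≢ 0 % p
    triple≢0 a b c eq = case <⇒%-injective excess<p 0<p (trans (sym excess) eq) of λ ()
      where
      ta = toℕ a ; tb = toℕ b ; tc = toℕ c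

      excess : (middle a + middle b + middle c) % p ≡ suc (ta + tb + tc) % p
      excess = trans (cong (_% p) (split k ta tb tc)) ([m+n]%n≡m%n (suc (ta + tb + tc)) p)
        where split : ∀ k x y z → 2 * suc k + x + (2 * suc k + y) + (2 * suc k + z) ≡ suc (x + y + z) + (5 + 6 * k)
              split = ℕ-Solver.solve-∀

      excess<p : suc (ta + tb + tc) < p
      excess<p = subst (suc (suc (ta + tb + tc)) ≤_) (split k)
        (≤-trans (s≤s (s≤s (+-mono-≤ (+-mono-≤ (toℕ≤pred[n] a) (toℕ≤pred[n] b)) (toℕ≤pred[n] c))))
                 (m≤m+n _ (3 + 3 * k)))
        where split : ∀ k → suc (suc (k + k + k)) + (3 + 3 * k) ≡ 5 + 6 * k
              split = ℕ-Solver.solve-∀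

  private
    3K≤p : 2 * suc k + suc k ≤ 5 + 6 * k
    3K≤p = subst (2 * suc k + suc k ≤_) (split k) (m≤m+n _ _)
      where split : ∀ k → 2 * suc k + suc k + (2 + 3 * k) ≡ 5 + 6 * k
            split = ℕ-Solver.solve-∀

  middleThird : Fin (suc k) → Fin (5 + 6 * k)
  middleThird t = inject≤ (2 * suc k ↑ʳ t) 3K≤p

  toℕ-middleThird : ∀ t → toℕ (middleThird t) ≡ middle t
  toℕ-middleThird t = trans (toℕ-inject≤ (2 * suc k ↑ʳ t) 3K≤p) (toℕ-↑ʳ (2 * suc k) t)

  middleThird-injective : Injective _≡_ _≡_ middleThird
  middleThird-injective {s} {t} eq =
    ↑ʳ-injective (2 * suc k) s t (inject≤-injective 3K≤p 3K≤p (2 * suc k ↑ʳ s) (2 * suc k ↑ʳ t) eq)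

-- j·k + r ↦ j·p + g r: the residues mod q·p whose reduction mod p lies in the image of g.
repeatBlocks : ∀ q {k p} → (Fin k → Fin p) → Fin (q * k) → Fin (q * p)
repeatBlocks q {k} g i = combine (quotient {q} k i) (g (remainder {q} k i))

module _ (q : ℕ) {k p : ℕ} (g : Fin k → Fin p) where

  private
    quot : Fin (q * k) → Fin q
    quot = quotient k
    rem : Fin (q * k) → Fin k
    rem = remainder {q} k

  repeatBlocks-injective : Injective _≡_ _≡_ g → Injective _≡_ _≡_ (repeatBlocks q g)
  repeatBlocks-injective g-injective {i} {j} eq = begin
    i                        ≡⟨ combine-remQuot {q} k i ⟨
    combine (quot i) (rem i) ≡⟨ cong₂ combine (proj₁ blocks≡) (g-injective (proj₂ blocks≡)) ⟩
    combine (quot j) (rem j) ≡⟨ combine-remQuot {q} k j ⟩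
    j                        ∎
    where
    open ≡-Reasoning
    blocks≡ = combine-injective (quot i) (g (rem i)) (quot j) (g (rem j)) eq

  repeatBlocks-% : .{{_ : NonZero p}} → ∀ i → toℕ (repeatBlocks q g i) % p ≡ toℕ (g (rem i)) % p
  repeatBlocks-% i = trans (cong (_% p) (toℕ-combine (quot i) (g (rem i))))
                           (%-remove-+ˡ (toℕ (g (rem i))) (m∣m*n (toℕ (quot i))))

middleThirdSidonSet : ∀ k q {e} .{{_ : NonZero q}} → e ≤ q * suc k → SidonSetExists 3 (q * (5 + 6 * k)) e
middleThirdSidonSet k q e≤qK = m , m-injective , sumFree⇒sidon ⦃ qp≢0 ⦄ m m-injective sumFree ≤-refl
  where
  qp≢0 = m*n≢0 q (5 + 6 * k)

  index : Fin _ → Fin (q * suc k)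
  index a = inject≤ a e≤qK

  m = repeatBlocks q (middleThird k) ∘ index

  m-injective : Injective _≡_ _≡_ m
  m-injective {a} {b} eq =
    inject≤-injective e≤qK e≤qK a b (repeatBlocks-injective q (middleThird k) (middleThird-injective k) eq)

  sumFree : SumFreeMod (q * (5 + 6 * k)) ⦃ qp≢0 ⦄ (toℕ ∘ m)
  sumFree = SumFreeMod-∣ ⦃ _ ⦄ ⦃ qp≢0 ⦄ (n∣m*n q)
    (SumFreeMod-residues (remainder {q} (suc k) ∘ index)
      (λ a → trans (repeatBlocks-% q (middleThird k) (index a)) (cong (_% (5 + 6 * k)) (toℕ-middleThird k _)))
      (middle-sumFree k))

odd⇒nonZero : ∀ {n} → n % 2 ≡ 1 → NonZero n
odd⇒nonZero {suc _} _ = _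

module OddDimension {d : ℕ} (d-odd : d % 2 ≡ 1) where

  2*halfSucc : 2 * halfSucc d ≡ suc d
  2*halfSucc = begin
    2 * (suc d / 2)            ≡⟨ cong (λ x → 2 * (x / 2)) suc-d≡ ⟩
    2 * (suc (d / 2) * 2 / 2)  ≡⟨ cong (2 *_) (m*n/n≡m (suc (d / 2)) 2) ⟩
    2 * suc (d / 2)            ≡⟨ *-comm 2 (suc (d / 2)) ⟩
    suc (d / 2) * 2            ≡⟨ suc-d≡ ⟨
    suc d                      ∎
    where
    open ≡-Reasoning
    suc-d≡ : suc d ≡ suc (d / 2) * 2
    suc-d≡ = cong suc (trans (%≡⇒≡+* d-odd) (cong suc (*-comm 2 (d / 2))))

  2c*halfSucc : ∀ c → (2 * c) * halfSucc d ≡ c * d + c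
  2c*halfSucc c = begin
    (2 * c) * halfSucc d  ≡⟨ cong (_* halfSucc d) (*-comm 2 c) ⟩
    (c * 2) * halfSucc d  ≡⟨ *-assoc c 2 (halfSucc d) ⟩
    c * (2 * halfSucc d)  ≡⟨ cong (c *_) 2*halfSucc ⟩
    c * suc d             ≡⟨ *-suc c d ⟩
    c + c * d             ≡⟨ +-comm c (c * d) ⟩
    c * d + c             ∎
    where open ≡-Reasoning

  oddDesign : ∀ {n} → 2 * d + 2 ≤ n → 2 ∣ n ⊎ 3 * d + 2 ≤ n → RegularDesignExists 3 n d
  oddDesign {n} 2d+2≤n 2∣n⊎3d+2≤n =
    oddSidonSet ⦃ >-nonZero (≤-trans (s≤s z≤n) (≤-trans (ℕ.m≤n+m 2 (2 * d)) 2d+2≤n)) ⦄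
      (subst (_≤ n) (sym (2c*halfSucc 2)) 2d+2≤n)
      (Sum.map₂ 6e≤2+n 2∣n⊎3d+2≤n)
    where
    6e≤2+n : 3 * d + 2 ≤ n → 6 * halfSucc d ≤ 2 + n
    6e≤2+n 3d+2≤n = subst (_≤ 2 + n) (sym (trans (2c*halfSucc 3) (+-suc (3 * d) 2))) (m≤n⇒m≤1+n (s≤s 3d+2≤n))

  divisorDesign : ∀ {n p} .{{_ : NonZero n}} → p ∣ n → p % 6 ≡ 5 →
                  p * (3 * d + 3) ≤ (p + 1) * n → RegularDesignExists 3 n d
  divisorDesign {p = p} (divides q refl) p%6≡5 bound =
    subst (λ p → SidonSetExists 3 (q * p) (halfSucc d)) (sym p≡)
      (middleThirdSidonSet k q ⦃ m*n≢0⇒m≢0 q ⦄ (cancel k q (halfSucc d) bound′))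
    where
    k = p / 6
    p≡ : p ≡ 5 + 6 * k
    p≡ = %≡⇒≡+* p%6≡5

    bound′ : (5 + 6 * k) * (6 * halfSucc d) ≤ (5 + 6 * k + 1) * (q * (5 + 6 * k))
    bound′ = subst (λ p → p * (6 * halfSucc d) ≤ (p + 1) * (q * p)) p≡
                   (subst (λ x → p * x ≤ (p + 1) * (q * p)) (sym (2c*halfSucc 3)) bound)

    cancel : ∀ k q e → (5 + 6 * k) * (6 * e) ≤ (5 + 6 * k + 1) * (q * (5 + 6 * k)) → e ≤ q * suc k
    cancel k q e = *-cancelˡ-≤ ((5 + 6 * k) * 6) ∘ subst₂ _≤_ (lhs k e) (rhs k q)
      where lhs : ∀ k e → (5 + 6 * k) * (6 * e) ≡ (5 + 6 * k) * 6 * e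
            lhs = ℕ-Solver.solve-∀
            rhs : ∀ k q → (5 + 6 * k + 1) * (q * (5 + 6 * k)) ≡ (5 + 6 * k) * 6 * (q * suc k)
            rhs = ℕ-Solver.solve-∀

proposition5p3 : (d : ℕ) → d % 2 ≡ 1 →
    ((n : ℕ) → n % 2 ≡ 0 → 2 * d + 2 ≤ n → RegularDesignExists 3 n d) ×
    ((n : ℕ) → n % 2 ≡ 1 → 3 * d + 2 ≤ n → RegularDesignExists 3 n d) ×
    ((n p : ℕ) → n % 2 ≡ 1 → p ∣ n → p % 6 ≡ 5 →
      p * (3 * d + 3) ≤ (p + 1) * n → RegularDesignExists 3 n d) ×
    ((n : ℕ) → n % 2 ≡ 1 → 5 ∣ n → 5 * (d + 1) ≤ 2 * n → RegularDesignExists 3 n d)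
proposition5p3 d d-odd =
  (λ n n-even bound → oddDesign bound (inj₁ (m%n≡0⇒n∣m n 2 n-even))) ,
  (λ n _ bound → oddDesign (≤-trans 2d+2≤3d+2 bound) (inj₂ bound)) ,
  (λ n p n-odd → divisorDesign ⦃ odd⇒nonZero n-odd ⦄) ,
  (λ n n-odd 5∣n bound → divisorDesign ⦃ odd⇒nonZero n-odd ⦄ 5∣n refl (tripled n bound))
  where
  open OddDimension {d} d-odd

  2d+2≤3d+2 : 2 * d + 2 ≤ 3 * d + 2
  2d+2≤3d+2 = ℕ.+-monoˡ-≤ 2 (ℕ.*-monoˡ-≤ d {2} {3} (s≤s (s≤s z≤n)))

  tripled : ∀ n → 5 * (d + 1) ≤ 2 * n → 5 * (3 * d + 3) ≤ (5 + 1) * n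
  tripled n = subst₂ _≤_ (lhs d) (rhs n) ∘ ℕ.*-monoʳ-≤ 3
    where lhs : ∀ d → 3 * (5 * (d + 1)) ≡ 5 * (3 * d + 3)
          lhs = ℕ-Solver.solve-∀
          rhs : ∀ n → 3 * (2 * n) ≡ (5 + 1) * n
          rhs = ℕ-Solver.solve-∀
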